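{- Let $T$ be a tree and let $v$ be a vertex of $T$. There exists $N$ such that, for all $k\ge N$, the tree obtained from $T$ by attaching $k$ new leaves at $v$ is graceful.
   Context: A tree with $n$ edges is graceful if there is an injective map $f$ from its vertices to $\{0,1,\ldots,n\}$ such that the induced edge labels $|f(x)-f(y)|$ over all edges $xy$ are exactly $\{1,\ldots,n\}$. -}

module Defs where

open import Data.Nat using (ℕ; zero; suc; _+_; _≤_; ∣_-_∣)
open import Data.Nat.Properties using ()
open import Data.Fin using (Fin; _↑ˡ_; _↑ʳ_)
open import Data.Fin.Base using ()
open import Data.List using (List; []; _∷_; _++_; map; length; [_])
open import Data.List.Relation.Unary.All using (All)
open import Data.List.Relation.Unary.AllPairs using (AllPairs)
open import Data.List.Relation.Unary.Linked using (Linked)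
open import Data.List.Relation.Unary.Unique.Propositional using (Unique)
open import Data.List.Membership.Propositional using (_∈_)
open import Data.List.Base using (allFin)
open import Data.Product using (Σ; ∃; _×_; _,_; proj₁; proj₂)
open import Data.Sum using (_⊎_)
open import Relation.Binary.PropositionalEquality using (_≡_; _≢_)
open import Relation.Binary.Construct.Closure.ReflexiveTransitive using (Star)
open import Relation.Nullary using (¬_)
open import Function.Definitions using (Injective)

-- A finite simple graph on vertex set Fin m, given by its list of edges
-- (each edge an (unordered) pair, recorded as an ordered pair).
Edges : ℕ → Set
Edges m = List (Fin m × Fin m)

Adj : {m : ℕ} → Edges m → Fin m → Fin m → Set
Adj E u w = ((u , w) ∈ E) ⊎ ((w , u) ∈ E)

SameEdge : {m : ℕ} → Fin m × Fin m → Fin m × Fin m → Set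
SameEdge (a , b) (c , d) = ((a ≡ c) × (b ≡ d)) ⊎ ((a ≡ d) × (b ≡ c))

Simple : {m : ℕ} → Edges m → Set
Simple E = All (λ e → proj₁ e ≢ proj₂ e) E × AllPairs (λ e e′ → ¬ SameEdge e e′) E

Connected : {m : ℕ} → Edges m → Set
Connected {m} E = (u w : Fin m) → Star (Adj E) u w

HasCycle : {m : ℕ} → Edges m → Set
HasCycle {m} E =
  Σ (Fin m) λ x → Σ (List (Fin m)) λ ys →
    (2 ≤ length ys) × Unique (x ∷ ys) × Linked (Adj E) (x ∷ ys ++ [ x ])

IsTree : {m : ℕ} → Edges m → Set
IsTree E = Simple E × Connected E × ¬ HasCycle E

edgeLabel : {m : ℕ} → (Fin m → ℕ) → Fin m × Fin m → ℕ
edgeLabel f (x , y) = ∣ f x - f y ∣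

IsGracefulLabelling : {m : ℕ} → Edges m → (Fin m → ℕ) → Set
IsGracefulLabelling {m} E f =
  Injective _≡_ _≡_ f
  × ((x : Fin m) → f x ≤ length E)
  × All (λ e → 1 ≤ edgeLabel f e × edgeLabel f e ≤ length E) E
  × ((j : ℕ) → 1 ≤ j → j ≤ length E → Σ (Fin m × Fin m) λ e → (e ∈ E) × (edgeLabel f e ≡ j))

Graceful : {m : ℕ} → Edges m → Set
Graceful {m} E = Σ (Fin m → ℕ) λ f → IsGracefulLabelling E f

attachLeaves : {m : ℕ} → Edges m → Fin m → (k : ℕ) → Edges (m + k)
attachLeaves {m} E v k =
  map (λ e → (proj₁ e ↑ˡ k , proj₂ e ↑ˡ k)) E
  ++ map (λ i → (v ↑ˡ k , m ↑ʳ i)) (allFin k)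

module Submission where

-- Rooting the tree at v, we label its vertices injectively with v ↦ 0 so that
-- the edge joining each u ≠ v to its parent carries the label of mirror u,
-- where mirror pairs off siblings (an unpaired child and the children of v
-- are their own mirror).  The edge labels are then pairwise distinct and are
-- exactly the vertex labels other than 0 (an "anchored" labelling).  With
-- k ≥ (sum of all labels) new leaves at v, the leaves take the k labels in
-- {1,…,|E|+k} not yet used on edges; since v has label 0, each leaf edge
-- carries its leaf's label, and the result is graceful.

open import Defs
open import Data.Nat as ℕ using (ℕ; zero; suc; _≤_; _<_; z≤n; s≤s; ∣_-_∣)
import Data.Nat.Properties as ℕP
open import Data.Integer as ℤ using (ℤ; +_; -[1+_]; 0ℤ)
import Data.Integer.Properties as ℤP
open import Data.Integer.Tactic.RingSolver using (solve-∀)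
import Data.Nat.Tactic.RingSolver as ℕSolver
open import Algebra.Properties.AbelianGroup ℤP.+-0-abelianGroup using (∙-cancelˡ; ∙-cancelʳ)
open import Data.Fin as F using (Fin; _↑ˡ_; _↑ʳ_; splitAt; join)
import Data.Fin.Properties as FP
open import Function.Definitions using (Injective)
open import Data.List using (List; []; _∷_; _++_; map; length; [_]; filter; lookup; allFin; upTo)
import Data.List.Properties as LP
open import Data.Nat.ListAction using (sum)
open import Data.List.Relation.Unary.All as All using (All; []; _∷_)
open import Data.List.Relation.Unary.AllPairs using (AllPairs; []; _∷_)
open import Data.List.Relation.Unary.Any using (here; there)
open import Data.List.Relation.Unary.Linked using (Linked; [-]; _∷_)
open import Data.List.Relation.Unary.Unique.Propositional using (Unique)
open import Data.List.Membership.Propositional using (_∈_; _∉_)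
open import Data.List.Membership.Propositional.Properties
  using (∈-∃++; ∈-++⁻; ∈-++⁺ˡ; ∈-++⁺ʳ; ∈-lookup; ∈-filter⁺; ∈-filter⁻; ∈-map⁺; ∈-map⁻; ∈-allFin; ∈-upTo⁺; ∈-upTo⁻)
import Data.List.Relation.Unary.Unique.Propositional.Properties as UP
import Data.List.Relation.Unary.AllPairs.Properties as APP
import Data.List.Relation.Unary.Any as Any
open import Data.List.Relation.Unary.Any.Properties using (lookup-index)
open import Data.Product using (Σ; _×_; _,_; proj₁; proj₂)
import Data.Product.Properties as PP
open import Data.Sum using (_⊎_; inj₁; inj₂; [_,_]′)
open import Data.Empty using (⊥-elim)
open import Data.Bool using (Bool; true; false; not)
open import Data.Maybe using (Maybe; just; nothing)
open import Relation.Binary.Definitions using (DecidableEquality)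
open import Relation.Binary.PropositionalEquality hiding ([_])
open import Relation.Binary.Construct.Closure.ReflexiveTransitive using (Star; ε; _◅_; _◅◅_)
import Relation.Binary.Construct.Closure.ReflexiveTransitive as Star
open import Relation.Binary.Definitions using (tri<; tri≈; tri>)
open import Relation.Nullary using (¬_; Dec; yes; no; ¬?)
open import Relation.Nullary.Decidable using (_×-dec_; _⊎-dec_)

unique-⊆-length : {A : Set} (xs ys : List A) → Unique xs → (∀ {x} → x ∈ xs → x ∈ ys) →
                  length xs ≤ length ys
unique-⊆-length [] ys _ _ = z≤n
unique-⊆-length (x ∷ xs) ys (x∉xs ∷ uxs) xs⊆ys with ∈-∃++ (xs⊆ys (here refl))
... | as , bs , refl = begin
    suc (length xs)         ≤⟨ s≤s (unique-⊆-length xs (as ++ bs) uxs xs⊆as++bs) ⟩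
    suc (length (as ++ bs)) ≡⟨ cong suc (LP.length-++ as) ⟩
    suc (length as ℕ.+ length bs) ≡⟨ sym (ℕP.+-suc (length as) (length bs)) ⟩
    length as ℕ.+ length (x ∷ bs) ≡⟨ sym (LP.length-++ as) ⟩
    length (as ++ x ∷ bs) ∎
  where
  open ℕP.≤-Reasoning
  xs⊆as++bs : ∀ {y} → y ∈ xs → y ∈ as ++ bs
  xs⊆as++bs {y} y∈xs with ∈-++⁻ as (xs⊆ys (there y∈xs))
  ... | inj₁ y∈as = ∈-++⁺ˡ y∈as
  ... | inj₂ (here refl) = ⊥-elim (All.lookup x∉xs y∈xs refl)
  ... | inj₂ (there y∈bs) = ∈-++⁺ʳ as y∈bs

length-filter-split : {A : Set} {P : A → Set} (P? : ∀ x → Dec (P x)) (xs : List A) →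
  length (filter P? xs) ℕ.+ length (filter (λ x → ¬? (P? x)) xs) ≡ length xs
length-filter-split P? [] = refl
length-filter-split P? (x ∷ xs) with P? x
... | yes _ = cong suc (length-filter-split P? xs)
... | no _ = trans (ℕP.+-suc _ _) (cong suc (length-filter-split P? xs))

lookup-injective : {A : Set} (xs : List A) → Unique xs → (i j : Fin (length xs)) →
                   lookup xs i ≡ lookup xs j → i ≡ j
lookup-injective (x ∷ xs) u F.zero F.zero eq = refl
lookup-injective (x ∷ xs) (x∉ ∷ u) F.zero (F.suc j) eq = ⊥-elim (All.lookup x∉ (∈-lookup j) eq)
lookup-injective (x ∷ xs) (x∉ ∷ u) (F.suc i) F.zero eq = ⊥-elim (All.lookup x∉ (∈-lookup i) (sym eq))
lookup-injective (x ∷ xs) (x∉ ∷ u) (F.suc i) (F.suc j) eq = cong F.suc (lookup-injective xs u i j eq)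

record Enumeration {A : Set} (k : ℕ) (xs : List A) : Set where
  field
    entry : Fin k → A
    entry-injective : ∀ i j → entry i ≡ entry j → i ≡ j
    entry-∈ : ∀ i → entry i ∈ xs
    entry-onto : ∀ {x} → x ∈ xs → Σ (Fin k) λ i → entry i ≡ x

enumerate : {A : Set} {k : ℕ} (xs : List A) → Unique xs → length xs ≡ k → Enumeration k xs
enumerate xs uxs refl = record
  { entry = lookup xs
  ; entry-injective = lookup-injective xs uxs
  ; entry-∈ = ∈-lookup
  ; entry-onto = λ x∈xs → Any.index x∈xs , sym (lookup-index x∈xs)
  }

module _ {A : Set} (_≟_ : DecidableEquality A) where
  open import Data.List.Membership.DecPropositional _≟_ using (_∈?_)

  length-remove : (xs ys : List A) → Unique xs → Unique ys → (∀ {y} → y ∈ ys → y ∈ xs) →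
    length ys ℕ.+ length (filter (λ x → ¬? (x ∈? ys)) xs) ≡ length xs
  length-remove xs ys uxs uys ys⊆xs =
    trans (cong (ℕ._+ length (filter (λ x → ¬? (x ∈? ys)) xs)) (sym kept≡ys))
          (length-filter-split (_∈? ys) xs)
    where
    kept≡ys : length (filter (_∈? ys) xs) ≡ length ys
    kept≡ys = ℕP.≤-antisym
      (unique-⊆-length _ ys (UP.filter⁺ (_∈? ys) uxs) (λ p → proj₂ (∈-filter⁻ (_∈? ys) {xs = xs} p)))
      (unique-⊆-length ys _ uys (λ p → ∈-filter⁺ (_∈? ys) (ys⊆xs p) p))

≤-sum : {A : Set} (f : A → ℕ) {xs : List A} {x : A} → x ∈ xs → f x ≤ sum (map f xs)
≤-sum f {y ∷ xs} (here refl) = ℕP.m≤m+n (f y) _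
≤-sum f {y ∷ xs} (there p) = ℕP.≤-trans (≤-sum f p) (ℕP.m≤n+m _ (f y))

least : (P : ℕ → Set) → (∀ n → Dec (P n)) → ∀ n → P n →
        Σ ℕ λ k → P k × (∀ j → j < k → ¬ P j)
least P P? n pn = search 0 n refl (λ j ())
  where
  -- invariant: i + fuel ≡ n, and no j below i satisfies P
  search : ∀ i fuel → i ℕ.+ fuel ≡ n → (∀ j → j < i → ¬ P j) →
           Σ ℕ λ k → P k × (∀ j → j < k → ¬ P j)
  search i fuel eq below with P? i
  ... | yes pi = i , pi , below
  search i zero eq below | no ¬pi = ⊥-elim (¬pi (subst P (sym (trans (sym (ℕP.+-identityʳ i)) eq)) pn))
  search i (suc fuel) eq below | no ¬pi = search (suc i) fuel (trans (sym (ℕP.+-suc i fuel)) eq) below′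
    where
    below′ : ∀ j → j < suc i → ¬ P j
    below′ j (s≤s j≤i) with ℕP.m≤n⇒m<n∨m≡n j≤i
    ... | inj₁ j<i = below j j<i
    ... | inj₂ refl = ¬pi

AllPairs-strengthen : {A : Set} {P : A → Set} {R S : A → A → Set} →
                      (∀ {x y} → P x → P y → R x y → S x y) →
                      ∀ {xs} → All P xs → AllPairs R xs → AllPairs S xs
AllPairs-strengthen f [] [] = []
AllPairs-strengthen f (px ∷ ps) (rx ∷ rs) =
  All.zipWith (λ (py , r) → f px py r) (ps , rx) ∷ AllPairs-strengthen f ps rs

odd-part-unique : ∀ a b c d → 2 ℕ.^ a ℕ.* suc (2 ℕ.* c) ≡ 2 ℕ.^ b ℕ.* suc (2 ℕ.* d) → a ≡ b × c ≡ d
odd-part-unique zero zero c d eq =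
  refl , ℕP.*-cancelˡ-≡ c d 2 (ℕP.suc-injective (trans (sym (ℕP.+-identityʳ _)) (trans eq (ℕP.+-identityʳ _))))
odd-part-unique zero (suc b) c d eq = ⊥-elim (ℕP.even≢odd (2 ℕ.^ b ℕ.* suc (2 ℕ.* d)) c
  (sym (trans (sym (ℕP.+-identityʳ _)) (trans eq (ℕP.*-assoc 2 (2 ℕ.^ b) _)))))
odd-part-unique (suc a) zero c d eq = ⊥-elim (ℕP.even≢odd (2 ℕ.^ a ℕ.* suc (2 ℕ.* c)) d
  (trans (sym (ℕP.*-assoc 2 (2 ℕ.^ a) _)) (trans eq (ℕP.+-identityʳ _))))
odd-part-unique (suc a) (suc b) c d eq with odd-part-unique a b c d (ℕP.*-cancelˡ-≡ _ _ 2
  (trans (sym (ℕP.*-assoc 2 (2 ℕ.^ a) _)) (trans eq (ℕP.*-assoc 2 (2 ℕ.^ b) _))))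
... | refl , c≡d = refl , c≡d

∸-pred : ∀ n k → suc k ≤ n → n ℕ.∸ k ≡ suc (n ℕ.∸ suc k)
∸-pred (suc n) zero _ = refl
∸-pred (suc n) (suc k) (s≤s k<n) = ∸-pred n k k<n

shift-to-ℕ : ∀ n i → ℤ.∣ i ∣ ≤ n → Σ ℕ λ w → + n ℤ.+ i ≡ + w
shift-to-ℕ n (+ k) _ = n ℕ.+ k , refl
shift-to-ℕ n -[1+ k ] k<n = n ℕ.∸ suc k , ℤP.⊖-≥ k<n

leading-digit-unique : ∀ a b s s′ K → 2 ℕ.* ℤ.∣ a ∣ < K → 2 ℕ.* ℤ.∣ b ∣ < K →
                       a ℤ.+ s ℤ.* + K ≡ b ℤ.+ s′ ℤ.* + K → s ≡ s′
leading-digit-unique a b s s′ K 2a<K 2b<K eq =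
  ℤP.i-j≡0⇒i≡j s s′ (ℤP.∣i∣≡0⇒i≡0 (multiple-below (ℤ.∣ s ℤ.- s′ ∣) small))
  where
  multiple-below : ∀ c → c ℕ.* K < K → c ≡ 0
  multiple-below zero _ = refl
  multiple-below (suc c) lt = ⊥-elim (ℕP.<⇒≱ lt (ℕP.m≤m+n K (c ℕ.* K)))
  id₁ : ∀ a s s′ K → (s ℤ.- s′) ℤ.* K ≡ (a ℤ.+ s ℤ.* K) ℤ.- a ℤ.- s′ ℤ.* K
  id₁ = solve-∀
  id₂ : ∀ a b s′ K → (b ℤ.+ s′ ℤ.* K) ℤ.- a ℤ.- s′ ℤ.* K ≡ b ℤ.- a
  id₂ = solve-∀
  difference : (s ℤ.- s′) ℤ.* + K ≡ b ℤ.- a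
  difference = trans (id₁ a s s′ (+ K)) (trans (cong (λ X → X ℤ.- a ℤ.- s′ ℤ.* + K) eq) (id₂ a b s′ (+ K)))
  small : ℤ.∣ s ℤ.- s′ ∣ ℕ.* K < K
  small = begin-strict
    ℤ.∣ s ℤ.- s′ ∣ ℕ.* K       ≡⟨ sym (ℤP.∣i*j∣≡∣i∣*∣j∣ (s ℤ.- s′) (+ K)) ⟩
    ℤ.∣ (s ℤ.- s′) ℤ.* + K ∣   ≡⟨ cong ℤ.∣_∣ difference ⟩
    ℤ.∣ b ℤ.- a ∣              ≤⟨ ℤP.∣i-j∣≤∣i∣+∣j∣ b a ⟩
    ℤ.∣ b ∣ ℕ.+ ℤ.∣ a ∣        <⟨ ℕP.*-cancelˡ-< 2 _ K (subst₂ _<_ (sym (ℕP.*-distribˡ-+ 2 ℤ.∣ b ∣ ℤ.∣ a ∣))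
                                     (cong (K ℕ.+_) (sym (ℕP.+-identityʳ K))) (ℕP.+-mono-< 2b<K 2a<K)) ⟩
    K ∎
    where open ℕP.≤-Reasoning

-- Pairing off a list: cut it into consecutive pairs (x₁ , x₂), (x₃ , x₄), …
-- The partner of u is returned together with whether u comes first in its
-- pair; an element left over at the end of an odd list has no partner.
module Pairing {A : Set} (_≟_ : DecidableEquality A) where

  partner : List A → A → Maybe (A × Bool)
  partner [] u = nothing
  partner (x ∷ []) u = nothing
  partner (x ∷ y ∷ r) u with u ≟ x
  ... | yes _ = just (y , true)
  ... | no _ with u ≟ y
  ...   | yes _ = just (x , false)
  ...   | no _ = partner r u

  private
    partner-skip : ∀ x y r u → u ≢ x → u ≢ y → partner (x ∷ y ∷ r) u ≡ partner r u
    partner-skip x y r u u≢x u≢y with u ≟ x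
    ... | yes u≡x = ⊥-elim (u≢x u≡x)
    ... | no _ with u ≟ y
    ...   | yes u≡y = ⊥-elim (u≢y u≡y)
    ...   | no _ = refl

    unpaired-skip : ∀ x y r u → partner (x ∷ y ∷ r) u ≡ nothing → u ≢ x × u ≢ y × partner r u ≡ nothing
    unpaired-skip x y r u e with u ≟ x
    unpaired-skip x y r u () | yes _
    ... | no u≢x with u ≟ y
    unpaired-skip x y r u () | no _ | yes _
    ...   | no u≢y = u≢x , u≢y , e

    partner-first : ∀ x y r → partner (x ∷ y ∷ r) x ≡ just (y , true)
    partner-first x y r with x ≟ x
    ... | yes _ = refl
    ... | no x≢x = ⊥-elim (x≢x refl)

    partner-second : ∀ x y r → x ≢ y → partner (x ∷ y ∷ r) y ≡ just (x , false)
    partner-second x y r x≢y with y ≟ x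
    ... | yes y≡x = ⊥-elim (x≢y (sym y≡x))
    ... | no _ with y ≟ y
    ...   | yes _ = refl
    ...   | no y≢y = ⊥-elim (y≢y refl)

  partner-symmetric : ∀ l u {z b} → Unique l → partner l u ≡ just (z , b) →
                      z ∈ l × partner l z ≡ just (u , not b)
  partner-symmetric (x ∷ y ∷ r) u ((x≢y ∷ x∉r) ∷ (y∉r ∷ ur)) e with u ≟ x
  ... | yes refl with e
  ...   | refl = there (here refl) , partner-second x y r x≢y
  partner-symmetric (x ∷ y ∷ r) u ((x≢y ∷ x∉r) ∷ (y∉r ∷ ur)) e | no _ with u ≟ y
  ... | yes refl with e
  ...   | refl = here refl , partner-first x y r
  partner-symmetric (x ∷ y ∷ r) u ((x≢y ∷ x∉r) ∷ (y∉r ∷ ur)) e | no _ | no _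
    with partner-symmetric r u ur e
  ... | z∈r , e′ = there (there z∈r) ,
      trans (partner-skip x y r _ (λ z≡x → All.lookup x∉r z∈r (sym z≡x))
                                  (λ z≡y → All.lookup y∉r z∈r (sym z≡y))) e′

  unpaired-unique : ∀ l {u u′} → u ∈ l → u′ ∈ l → partner l u ≡ nothing → partner l u′ ≡ nothing → u ≡ u′
  unpaired-unique (x ∷ []) (here refl) (here refl) _ _ = refl
  unpaired-unique (x ∷ y ∷ r) {u} {u′} u∈ u′∈ e e′
    with unpaired-skip x y r u e | unpaired-skip x y r u′ e′
  ... | u≢x , u≢y , e₀ | u′≢x , u′≢y , e₀′ =
    unpaired-unique r (beyond-first-pair u∈ u≢x u≢y) (beyond-first-pair u′∈ u′≢x u′≢y) e₀ e₀′
    where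
    beyond-first-pair : ∀ {w} → w ∈ x ∷ y ∷ r → w ≢ x → w ≢ y → w ∈ r
    beyond-first-pair (here w≡x) w≢x _ = ⊥-elim (w≢x w≡x)
    beyond-first-pair (there (here w≡y)) _ w≢y = ⊥-elim (w≢y w≡y)
    beyond-first-pair (there (there w∈r)) _ _ = w∈r

-- The
-- essential consequence of acyclicity is that every edge joins a vertex to
-- its parent.
module RootedTree {m : ℕ} (E : Edges m) (v : Fin m) (tree : IsTree E) where

  private
    simple : Simple E
    simple = proj₁ tree

    open import Data.List.Membership.DecPropositional (PP.≡-dec (FP._≟_ {m}) (FP._≟_ {m}))
      using () renaming (_∈?_ to _∈E?_)

  adjacent? : ∀ a b → Dec (Adj E a b)
  adjacent? a b = ((a , b) ∈E? E) ⊎-dec ((b , a) ∈E? E)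

  WalkToRoot : ℕ → Fin m → Set
  WalkToRoot zero u = u ≡ v
  WalkToRoot (suc n) u = Σ (Fin m) λ w → Adj E u w × WalkToRoot n w

  walkToRoot? : ∀ n u → Dec (WalkToRoot n u)
  walkToRoot? zero u = u FP.≟ v
  walkToRoot? (suc n) u = FP.any? (λ w → adjacent? u w ×-dec walkToRoot? n w)

  star⇒walk : ∀ {u w} → Star (Adj E) u w → w ≡ v → Σ ℕ λ n → WalkToRoot n u
  star⇒walk ε w≡v = 0 , w≡v
  star⇒walk (a ◅ s) w≡v with star⇒walk s w≡v
  ... | n , walk = suc n , _ , a , walk

  -- depth and parent are only used through the facts established in this block
  abstract
    shortest : ∀ u → Σ ℕ λ k → WalkToRoot k u × (∀ j → j < k → ¬ WalkToRoot j u)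
    shortest u = least (λ n → WalkToRoot n u) (λ n → walkToRoot? n u) _
                   (proj₂ (star⇒walk (proj₁ (proj₂ tree) u v) refl))

    depth : Fin m → ℕ
    depth u = proj₁ (shortest u)

    depth-walk : ∀ u → WalkToRoot (depth u) u
    depth-walk u = proj₁ (proj₂ (shortest u))

    depth-minimal : ∀ u j → WalkToRoot j u → depth u ≤ j
    depth-minimal u j walk with ℕP.<-cmp j (depth u)
    ... | tri< j<d _ _ = ⊥-elim (proj₂ (proj₂ (shortest u)) j j<d walk)
    ... | tri≈ _ refl _ = ℕP.≤-refl
    ... | tri> _ _ j>d = ℕP.<⇒≤ j>d

    next : ∀ {u} n → WalkToRoot n u → Fin m
    next zero _ = v
    next (suc n) walk = proj₁ walk

    parent : Fin m → Fin m
    parent u = next (depth u) (depth-walk u)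

    depth≡0⇒root : ∀ u → depth u ≡ 0 → u ≡ v
    depth≡0⇒root u eq = go (depth u) (depth-walk u) eq
      where go : ∀ n → WalkToRoot n u → n ≡ 0 → u ≡ v
            go zero walk _ = walk

    depth-root : depth v ≡ 0
    depth-root = ℕP.n≤0⇒n≡0 (depth-minimal v 0 refl)

    parent-spec : ∀ u → u ≢ v → Adj E u (parent u) × suc (depth (parent u)) ≡ depth u
    parent-spec u u≢v = go (depth u) (depth-walk u) refl
      where
      go : ∀ n (walk : WalkToRoot n u) → n ≡ depth u →
           Adj E u (next n walk) × suc (depth (next n walk)) ≡ depth u
      go zero walk _ = ⊥-elim (u≢v walk)
      go (suc n) (w , a , walk) n≡d = a , ℕP.≤-antisym
        (subst (suc (depth w) ≤_) n≡d (s≤s (depth-minimal w n walk)))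
        (depth-minimal u (suc (depth w)) (w , a , depth-walk w))

  depth-parent : ∀ u → u ≢ v → suc (depth (parent u)) ≡ depth u
  depth-parent u u≢v = proj₂ (parent-spec u u≢v)

  depth-suc⇒≢root : ∀ {u n} → depth u ≡ suc n → u ≢ v
  depth-suc⇒≢root eq refl = ℕP.0≢1+n (trans (sym depth-root) eq)

  stepVertices : ∀ {R : Fin m → Fin m → Set} {a c} → Star R a c → List (Fin m)
  stepVertices ε = []
  stepVertices (_◅_ {j = b} _ w) = b ∷ stepVertices w

  vertices : ∀ {R : Fin m → Fin m → Set} {a c} → Star R a c → List (Fin m)
  vertices {a = a} w = a ∷ stepVertices w

  private
    open import Data.List.Membership.DecPropositional (FP._≟_ {m}) using () renaming (_∈?_ to _∈V?_)

    suffixFrom : ∀ {R : Fin m → Fin m → Set} {a b c} (w : Star R b c) → a ∈ vertices w → Star R a c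
    suffixFrom ε (here refl) = ε
    suffixFrom (r ◅ w) (here refl) = r ◅ w
    suffixFrom (r ◅ w) (there p) = suffixFrom w p

    suffixFrom-unique : ∀ {R : Fin m → Fin m → Set} {a b c} (w : Star R b c) (p : a ∈ vertices w) →
                        Unique (vertices w) → Unique (vertices (suffixFrom w p))
    suffixFrom-unique ε (here refl) u = u
    suffixFrom-unique (r ◅ w) (here refl) u = u
    suffixFrom-unique (r ◅ w) (there p) (_ ∷ u) = suffixFrom-unique w p u

  toPath : ∀ {R : Fin m → Fin m → Set} {a c} → Star R a c → Σ (Star R a c) λ w → Unique (vertices w)
  toPath ε = ε , [] ∷ []
  toPath {a = a} (r ◅ w) with toPath w
  ... | w′ , u′ with a ∈V? vertices w′
  ...   | yes a∈ = suffixFrom w′ a∈ , suffixFrom-unique w′ a∈ u′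
  ...   | no a∉ = r ◅ w′ , All.tabulate (λ z∈ a≡z → a∉ (subst (_∈ vertices w′) (sym a≡z) z∈)) ∷ u′

  module _ {x y : Fin m} (xy∈E : (x , y) ∈ E) where

    AvoidingStep : Fin m → Fin m → Set
    AvoidingStep a b = Adj E a b × ¬ SameEdge (a , b) (x , y)

    private
      closes : ∀ {a c} (w : Star AvoidingStep a c) → Adj E c x →
               Linked (Adj E) (a ∷ stepVertices w ++ [ x ])
      closes ε c~x = c~x ∷ [-]
      closes (r ◅ w) c~x = proj₁ r ∷ closes w c~x

    avoiding-walk⇒cycle : Star AvoidingStep x y → HasCycle E
    avoiding-walk⇒cycle w with toPath w
    ... | ε , _ = ⊥-elim (All.lookup (proj₁ simple) xy∈E refl)
    ... | r ◅ ε , _ = ⊥-elim (proj₂ r (inj₁ (refl , refl)))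
    ... | p@(_ ◅ _ ◅ _) , u = x , stepVertices p , s≤s (s≤s z≤n) , u , closes p (inj₂ xy∈E)

  ParentStep : Fin m → Fin m → Set
  ParentStep a b = a ≢ v × b ≡ parent a

  walkUp : ∀ n u → depth u ≡ n → Star ParentStep u v
  walkUp zero u eq = subst (λ a → Star ParentStep a v) (sym (depth≡0⇒root u eq)) ε
  walkUp (suc n) u eq = (u≢v , refl) ◅ walkUp n (parent u) (ℕP.suc-injective (trans (depth-parent u u≢v) eq))
    where
    u≢v : u ≢ v
    u≢v = depth-suc⇒≢root eq

  -- Every edge of the tree joins a non-root vertex to its parent: otherwise
  -- going up from one end to the root and down to the other end avoids the edge.
  edge-is-parent-edge : ∀ {x y} → (x , y) ∈ E → ParentStep x y ⊎ ParentStep y x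
  edge-is-parent-edge {x} {y} xy∈E with (¬? (x FP.≟ v)) ×-dec (y FP.≟ parent x)
  ... | yes x↑y = inj₁ x↑y
  ... | no ¬x↑y with (¬? (y FP.≟ v)) ×-dec (x FP.≟ parent y)
  ... | yes y↑x = inj₂ y↑x
  ... | no ¬y↑x = ⊥-elim (proj₂ (proj₂ tree) (avoiding-walk⇒cycle xy∈E
        (Star.map avoiding (Star.map inj₁ (walkUp _ x refl) ◅◅ Star.reverse inj₂ (walkUp _ y refl)))))
    where
    parent-adj : ∀ {a b} → ParentStep a b → Adj E a b
    parent-adj (a≢v , refl) = proj₁ (parent-spec _ a≢v)

    adj-sym : ∀ {a b} → Adj E a b → Adj E b a
    adj-sym (inj₁ p) = inj₂ p
    adj-sym (inj₂ p) = inj₁ p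

    avoiding : ∀ {a b} → ParentStep a b ⊎ ParentStep b a → AvoidingStep xy∈E a b
    avoiding (inj₁ s) = parent-adj s , λ where
      (inj₁ (refl , refl)) → ¬x↑y s
      (inj₂ (refl , refl)) → ¬y↑x s
    avoiding (inj₂ s) = adj-sym (parent-adj s) , λ where
      (inj₁ (refl , refl)) → ¬y↑x s
      (inj₂ (refl , refl)) → ¬x↑y s

-- An anchored labelling of (E , v): an injective vertex labelling with v ↦ 0
-- whose edge labels are pairwise distinct and include every other vertex label.
-- (For a tree both families have m - 1 members, so they then coincide.)
record AnchoredLabelling {m : ℕ} (E : Edges m) (v : Fin m) : Set where
  field
    label : Fin m → ℕ
    label-injective : ∀ x y → label x ≡ label y → x ≡ y
    label-root : label v ≡ 0
    label-is-edge-label : ∀ x → x ≢ v → Σ (Fin m × Fin m) λ e → e ∈ E × edgeLabel label e ≡ label x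
    edge-labels-distinct : Unique (map (edgeLabel label) E)

-- An anchored labelling extends to a graceful labelling once enough leaves
-- are attached at v: the leaves receive exactly the labels in {1,…,|E|+k}
-- that are not yet edge labels, so their edges (to v, labelled 0) fill the gaps.
module WithLeaves {m : ℕ} (E : Edges m) (v : Fin m)
  (loopless : All (λ e → proj₁ e ≢ proj₂ e) E) (A : AnchoredLabelling E v) where

  open AnchoredLabelling A renaming (label to L)

  bound : ℕ
  bound = sum (map L (allFin m))

  L≤bound : ∀ x → L x ≤ bound
  L≤bound x = ≤-sum L (∈-allFin x)

  module _ (k : ℕ) (bound≤k : bound ≤ k) where
    open import Data.List.Membership.DecPropositional ℕP._≟_ using (_∈?_)

    n : ℕ
    n = length E

    size : ℕ
    size = n ℕ.+ k

    edgeLabels : List ℕ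
    edgeLabels = map (edgeLabel L) E

    range : List ℕ
    range = map suc (upTo size)

    missing : List ℕ
    missing = filter (λ j → ¬? (j ∈? edgeLabels)) range

    ∈range⁺ : ∀ {j} → 1 ≤ j → j ≤ size → j ∈ range
    ∈range⁺ {suc j} _ j<size = ∈-map⁺ suc (∈-upTo⁺ j<size)

    ∈range⁻ : ∀ {j} → j ∈ range → 1 ≤ j × j ≤ size
    ∈range⁻ j∈ with ∈-map⁻ suc j∈
    ... | i , i∈ , refl = s≤s z≤n , ∈-upTo⁻ i∈

    edge-label-range : ∀ {e} → e ∈ E → 1 ≤ edgeLabel L e × edgeLabel L e ≤ size
    edge-label-range {x , y} e∈E = nonzero , ℕP.≤-trans (ℕP.∣m-n∣≤m⊔n (L x) (L y))
        (ℕP.⊔-lub (below x) (below y))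
      where
      below : ∀ z → L z ≤ size
      below z = ℕP.≤-trans (L≤bound z) (ℕP.≤-trans bound≤k (ℕP.m≤n+m k n))
      nonzero : 1 ≤ ∣ L x - L y ∣
      nonzero with ∣ L x - L y ∣ in eq
      ... | zero = ⊥-elim (All.lookup loopless e∈E (label-injective x y (ℕP.∣m-n∣≡0⇒m≡n eq)))
      ... | suc _ = s≤s z≤n

    range-unique : Unique range
    range-unique = UP.map⁺ ℕP.suc-injective (UP.upTo⁺ size)

    length-missing : length missing ≡ k
    length-missing = ℕP.+-cancelˡ-≡ n _ _ (begin
      n ℕ.+ length missing                  ≡⟨ cong (ℕ._+ length missing) (sym (LP.length-map (edgeLabel L) E)) ⟩
      length edgeLabels ℕ.+ length missing  ≡⟨ length-remove ℕP._≟_ range edgeLabels range-unique edge-labels-distinct edgeLabels⊆range ⟩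
      length range                          ≡⟨ trans (LP.length-map suc (upTo size)) (LP.length-upTo size) ⟩
      size ∎)
      where
      open ≡-Reasoning
      edgeLabels⊆range : ∀ {j} → j ∈ edgeLabels → j ∈ range
      edgeLabels⊆range j∈ with ∈-map⁻ (edgeLabel L) j∈
      ... | e , e∈E , refl = ∈range⁺ (proj₁ (edge-label-range e∈E)) (proj₂ (edge-label-range e∈E))

    leaves : Enumeration k missing
    leaves = enumerate missing (UP.filter⁺ (λ j → ¬? (j ∈? edgeLabels)) range-unique) length-missing

    open Enumeration leaves
      renaming (entry to leafLabel; entry-injective to leafLabel-injective; entry-onto to missing-is-leafLabel)

    leafLabel-missing : ∀ i → (1 ≤ leafLabel i × leafLabel i ≤ size) × leafLabel i ∉ edgeLabels
    leafLabel-missing i with ∈-filter⁻ (λ j → ¬? (j ∈? edgeLabels)) {xs = range} (entry-∈ i)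
    ... | i∈range , i∉ = ∈range⁻ i∈range , i∉

    -- an old vertex label is 0 or an edge label, so never a leaf label
    old≢leaf : ∀ x i → L x ≢ leafLabel i
    old≢leaf x i eq with x FP.≟ v
    ... | yes refl = ℕP.<⇒≢ (proj₁ (proj₁ (leafLabel-missing i))) (trans (sym label-root) eq)
    ... | no x≢v with label-is-edge-label x x≢v
    ... | e , e∈E , eL = proj₂ (leafLabel-missing i) (subst (_∈ edgeLabels) (trans eL eq) (∈-map⁺ (edgeLabel L) e∈E))

    labelling : Fin (m ℕ.+ k) → ℕ
    labelling w = [ L , leafLabel ]′ (splitAt m w)

    labelling-old : ∀ x → labelling (x ↑ˡ k) ≡ L x
    labelling-old x rewrite FP.splitAt-↑ˡ m x k = refl

    labelling-new : ∀ i → labelling (m ↑ʳ i) ≡ leafLabel i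
    labelling-new i rewrite FP.splitAt-↑ʳ m k i = refl

    labelling-injective : Injective _≡_ _≡_ labelling
    labelling-injective {a} {b} eq = begin
      a                          ≡⟨ sym (FP.join-splitAt m k a) ⟩
      join m k (splitAt m a)     ≡⟨ cong (join m k) (separate (splitAt m a) (splitAt m b) eq) ⟩
      join m k (splitAt m b)     ≡⟨ FP.join-splitAt m k b ⟩
      b ∎
      where
      open ≡-Reasoning
      separate : ∀ s t → [ L , leafLabel ]′ s ≡ [ L , leafLabel ]′ t → s ≡ t
      separate (inj₁ x) (inj₁ y) eq = cong inj₁ (label-injective x y eq)
      separate (inj₁ x) (inj₂ j) eq = ⊥-elim (old≢leaf x j eq)
      separate (inj₂ i) (inj₁ y) eq = ⊥-elim (old≢leaf y i (sym eq))
      separate (inj₂ i) (inj₂ j) eq = cong inj₂ (leafLabel-injective i j eq)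

    E′ : Edges (m ℕ.+ k)
    E′ = attachLeaves E v k

    oldEdge : Fin m × Fin m → Fin (m ℕ.+ k) × Fin (m ℕ.+ k)
    oldEdge e = proj₁ e ↑ˡ k , proj₂ e ↑ˡ k

    leafEdge : Fin k → Fin (m ℕ.+ k) × Fin (m ℕ.+ k)
    leafEdge i = v ↑ˡ k , m ↑ʳ i

    length-E′ : length E′ ≡ size
    length-E′ = trans (LP.length-++ (map oldEdge E))
      (cong₂ ℕ._+_ (LP.length-map oldEdge E) (trans (LP.length-map leafEdge (allFin k)) (LP.length-tabulate _)))

    oldEdge-label : ∀ e → edgeLabel labelling (oldEdge e) ≡ edgeLabel L e
    oldEdge-label (x , y) = cong₂ ∣_-_∣ (labelling-old x) (labelling-old y)

    leafEdge-label : ∀ i → edgeLabel labelling (leafEdge i) ≡ leafLabel i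
    leafEdge-label i = cong₂ ∣_-_∣ (trans (labelling-old v) label-root) (labelling-new i)

    labelling-bounded : ∀ w → labelling w ≤ size
    labelling-bounded w with splitAt m w
    ... | inj₁ x = ℕP.≤-trans (L≤bound x) (ℕP.≤-trans bound≤k (ℕP.m≤n+m k n))
    ... | inj₂ i = proj₂ (proj₁ (leafLabel-missing i))

    edge-label-in-range : ∀ {e} → e ∈ E′ → 1 ≤ edgeLabel labelling e × edgeLabel labelling e ≤ size
    edge-label-in-range e∈ with ∈-++⁻ (map oldEdge E) e∈
    ... | inj₁ p with ∈-map⁻ oldEdge p
    ...   | e , e∈E , refl rewrite oldEdge-label e = edge-label-range e∈E
    edge-label-in-range e∈ | inj₂ p with ∈-map⁻ leafEdge p
    ...   | i , _ , refl rewrite leafEdge-label i = proj₁ (leafLabel-missing i)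

    every-label-used : ∀ j → 1 ≤ j → j ≤ size →
                       Σ (Fin (m ℕ.+ k) × Fin (m ℕ.+ k)) λ e → e ∈ E′ × edgeLabel labelling e ≡ j
    every-label-used j 1≤j j≤size with j ∈? edgeLabels
    ... | yes j∈ with ∈-map⁻ (edgeLabel L) j∈
    ...   | e , e∈E , refl = oldEdge e , ∈-++⁺ˡ (∈-map⁺ oldEdge e∈E) , oldEdge-label e
    every-label-used j 1≤j j≤size | no j∉
      with missing-is-leafLabel (∈-filter⁺ (λ j → ¬? (j ∈? edgeLabels)) (∈range⁺ 1≤j j≤size) j∉)
    ... | i , i↦j = leafEdge i , ∈-++⁺ʳ (map oldEdge E) (∈-map⁺ leafEdge (∈-allFin i)) ,
                    trans (leafEdge-label i) i↦j

    graceful : Graceful E′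
    graceful = labelling , labelling-injective ,
      (λ w → subst (labelling w ≤_) (sym length-E′) (labelling-bounded w)) ,
      All.tabulate (λ {e} e∈ → subst (λ s → 1 ≤ edgeLabel labelling e × edgeLabel labelling e ≤ s)
                                 (sym length-E′) (edge-label-in-range e∈)) ,
      (λ j 1≤j j≤ → every-label-used j 1≤j (subst (j ≤_) length-E′ j≤))

  graceful-with-leaves : Σ ℕ λ N → (k : ℕ) → N ≤ k → Graceful (attachLeaves E v k)
  graceful-with-leaves = bound , graceful

-- If each edge joining u to its parent carries the label of mirror u, where
-- mirror is an involution of the non-root vertices, the labelling is anchored:
-- edge labels are then a bijective image of the non-root vertex labels.
module Mirrored {m : ℕ} (E : Edges m) (v : Fin m) (tree : IsTree E)
  (L : Fin m → ℕ) (L-injective : ∀ x y → L x ≡ L y → x ≡ y) (L-root : L v ≡ 0)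
  (mirror : Fin m → Fin m)
  (mirror-nonroot : ∀ u → u ≢ v → mirror u ≢ v)
  (mirror-involutive : ∀ u → u ≢ v → mirror (mirror u) ≡ u)
  (parent-edge-label : ∀ u → u ≢ v → ∣ L u - L (RootedTree.parent E v tree u) ∣ ≡ L (mirror u))
  where
  open RootedTree E v tree

  private
    ParentEdge : Fin m × Fin m → Set
    ParentEdge e = Σ (Fin m) λ c → c ≢ v × SameEdge e (c , parent c)

    parentEdgeOf : ∀ {e} → e ∈ E → ParentEdge e
    parentEdgeOf {x , y} e∈E with edge-is-parent-edge e∈E
    ... | inj₁ (x≢v , y≡px) = x , x≢v , inj₁ (refl , y≡px)
    ... | inj₂ (y≢v , x≡py) = y , y≢v , inj₂ (x≡py , refl)

    parentEdge-label : ∀ {e} → ((c , _ , _) : ParentEdge e) → edgeLabel L e ≡ L (mirror c)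
    parentEdge-label (c , c≢v , inj₁ (refl , refl)) = parent-edge-label c c≢v
    parentEdge-label (c , c≢v , inj₂ (refl , refl)) =
      trans (ℕP.∣-∣-comm (L (parent c)) (L c)) (parent-edge-label c c≢v)

    same-child⇒same-edge : ∀ {e e′} c → SameEdge e (c , parent c) → SameEdge e′ (c , parent c) → SameEdge e e′
    same-child⇒same-edge c (inj₁ (refl , refl)) (inj₁ (refl , refl)) = inj₁ (refl , refl)
    same-child⇒same-edge c (inj₁ (refl , refl)) (inj₂ (refl , refl)) = inj₂ (refl , refl)
    same-child⇒same-edge c (inj₂ (refl , refl)) (inj₁ (refl , refl)) = inj₂ (refl , refl)
    same-child⇒same-edge c (inj₂ (refl , refl)) (inj₂ (refl , refl)) = inj₁ (refl , refl)

    -- distinct edges have distinct non-root endpoints, hence distinct labels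
    distinct-labels : ∀ {e e′} → ParentEdge e → ParentEdge e′ → ¬ SameEdge e e′ → edgeLabel L e ≢ edgeLabel L e′
    distinct-labels p@(c , c≢v , c~e) p′@(c′ , c′≢v , c′~e′) e≁e′ eq
      with L-injective _ _ (trans (sym (parentEdge-label p)) (trans eq (parentEdge-label p′)))
    ... | mc≡mc′ with trans (sym (mirror-involutive c c≢v)) (trans (cong mirror mc≡mc′) (mirror-involutive c′ c′≢v))
    ... | refl = e≁e′ (same-child⇒same-edge c c~e c′~e′)

  anchored : AnchoredLabelling E v
  anchored = record
    { label = L
    ; label-injective = L-injective
    ; label-root = L-root
    ; label-is-edge-label = covered
    ; edge-labels-distinct =
        APP.map⁺ (AllPairs-strengthen distinct-labels (All.tabulate parentEdgeOf) (proj₂ (proj₁ tree)))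
    }
    where
    label-above : ∀ x → x ≢ v → ∣ L (mirror x) - L (parent (mirror x)) ∣ ≡ L x
    label-above x x≢v = trans (parent-edge-label (mirror x) (mirror-nonroot x x≢v)) (cong L (mirror-involutive x x≢v))

    covered : ∀ x → x ≢ v → Σ (Fin m × Fin m) λ e → e ∈ E × edgeLabel L e ≡ L x
    covered x x≢v with proj₁ (parent-spec (mirror x) (mirror-nonroot x x≢v))
    ... | inj₁ e∈E = _ , e∈E , label-above x x≢v
    ... | inj₂ e∈E = _ , e∈E , trans (ℕP.∣-∣-comm (L (parent (mirror x))) (L (mirror x))) (label-above x x≢v)

-- Children of each non-root vertex are paired off; u then receives
--   label u = 2^(B - depth u) · (2 · shifted u + 1)      (B bounds all depths),
-- where the offsets shifted u ∈ ℕ satisfy, with p the parent of u: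
--   shifted u = shifted p                 if u is left unpaired,
--   shifted u + shifted z = 2 · shifted p  if u is paired with z,
-- so that label p = 2 · label u, resp. label p = label u + label z.  Either
-- way the edge u p carries the label of mirror u (u itself, resp. z); the
-- same holds trivially for children of the root, labelled 0.  Offsets are
-- built as signed base-Q expansions along the path to v whose digit at u
-- identifies u among its siblings, which makes the labelling injective.
module Construction {m : ℕ} (E : Edges m) (v : Fin m) (tree : IsTree E) where
  open RootedTree E v tree
  open Pairing (FP._≟_ {m})

  IsChild : Fin m → Fin m → Set
  IsChild w z = parent z ≡ w × z ≢ v

  isChild? : ∀ w z → Dec (IsChild w z)
  isChild? w z = (parent z FP.≟ w) ×-dec ¬? (z FP.≟ v)

  children : Fin m → List (Fin m)
  children w = filter (isChild? w) (allFin m)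

  children-unique : ∀ w → Unique (children w)
  children-unique w = UP.filter⁺ (isChild? w) (UP.allFin⁺ m)

  ∈children⁺ : ∀ {z w} → IsChild w z → z ∈ children w
  ∈children⁺ {z} {w} = ∈-filter⁺ (isChild? w) (∈-allFin z)

  ∈children⁻ : ∀ {z w} → z ∈ children w → IsChild w z
  ∈children⁻ {z} {w} p = proj₂ (∈-filter⁻ (isChild? w) {xs = allFin m} p)

  -- the partner of u among its siblings (meaningful when the parent is not the root)
  sibling : Fin m → Maybe (Fin m × Bool)
  sibling u = partner (children (parent u)) u

  -- the digit of u: distinct for distinct siblings, opposite for partners, 0 if unpaired
  pairDigit : Fin m → Maybe (Fin m × Bool) → ℤ
  pairDigit u nothing = 0ℤ
  pairDigit u (just (z , true)) = + suc (2 ℕ.* F.toℕ u)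
  pairDigit u (just (z , false)) = -[1+ 2 ℕ.* F.toℕ z ]

  pairMirror : Fin m → Maybe (Fin m × Bool) → Fin m
  pairMirror u nothing = u
  pairMirror u (just (z , _)) = z

  digit : Fin m → ℤ
  digit u with parent u FP.≟ v
  ... | yes _ = + suc (2 ℕ.* F.toℕ u)
  ... | no _ = pairDigit u (sibling u)

  mirror : Fin m → Fin m
  mirror u with parent u FP.≟ v
  ... | yes _ = u
  ... | no _ = pairMirror u (sibling u)

  odd<2m : ∀ (x : Fin m) → suc (2 ℕ.* F.toℕ x) ≤ 2 ℕ.* m
  odd<2m x = ℕP.≤-trans (ℕP.n≤1+n _) (subst (_≤ 2 ℕ.* m) (ℕP.*-distribˡ-+ 2 1 (F.toℕ x)) (ℕP.*-monoʳ-≤ 2 (FP.toℕ<n x)))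

  digit-bound : ∀ u → ℤ.∣ digit u ∣ ≤ 2 ℕ.* m
  digit-bound u with parent u FP.≟ v
  ... | yes _ = odd<2m u
  ... | no _ with sibling u
  ...   | nothing = z≤n
  ...   | just (z , true) = odd<2m u
  ...   | just (z , false) = odd<2m z

  digit-inner : ∀ u → parent u ≢ v → digit u ≡ pairDigit u (sibling u)
  digit-inner u pu≢v with parent u FP.≟ v
  ... | yes pu≡v = ⊥-elim (pu≢v pu≡v)
  ... | no _ = refl

  mirror-inner : ∀ u → parent u ≢ v → mirror u ≡ pairMirror u (sibling u)
  mirror-inner u pu≢v with parent u FP.≟ v
  ... | yes pu≡v = ⊥-elim (pu≢v pu≡v)
  ... | no _ = refl

  mirror-rootChild : ∀ u → parent u ≡ v → mirror u ≡ u
  mirror-rootChild u pu≡v with parent u FP.≟ v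
  ... | yes _ = refl
  ... | no pu≢v = ⊥-elim (pu≢v pu≡v)

  record Partners (u z : Fin m) : Set where
    field
      partner-child : IsChild (parent u) z
      digit-opposite : digit z ≡ ℤ.- digit u
      mirror-left : mirror u ≡ z
      mirror-right : mirror z ≡ u

  partners : ∀ {u z b} → parent u ≢ v → sibling u ≡ just (z , b) → Partners u z
  partners {u} {z} {b} pu≢v su with partner-symmetric (children (parent u)) u (children-unique (parent u)) su
  ... | z∈ , sz′ = record
    { partner-child = z-child
    ; digit-opposite = begin
        digit z                              ≡⟨ digit-inner z pz≢v ⟩
        pairDigit z (sibling z)              ≡⟨ cong (pairDigit z) sz ⟩
        pairDigit z (just (u , not b))       ≡⟨ opposite b ⟩
        ℤ.- pairDigit u (just (z , b))       ≡⟨ cong (λ s → ℤ.- pairDigit u s) (sym su) ⟩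
        ℤ.- pairDigit u (sibling u)          ≡⟨ cong ℤ.-_ (sym (digit-inner u pu≢v)) ⟩
        ℤ.- digit u ∎
    ; mirror-left = trans (mirror-inner u pu≢v) (cong (pairMirror u) su)
    ; mirror-right = trans (mirror-inner z pz≢v) (cong (pairMirror z) sz)
    }
    where
    open ≡-Reasoning
    z-child : IsChild (parent u) z
    z-child = ∈children⁻ z∈
    pz≢v : parent z ≢ v
    pz≢v pz≡v = pu≢v (trans (sym (proj₁ z-child)) pz≡v)
    sz : sibling z ≡ just (u , not b)
    sz = subst (λ w → partner (children w) z ≡ just (u , not b)) (sym (proj₁ z-child)) sz′
    opposite : ∀ b → pairDigit z (just (u , not b)) ≡ ℤ.- pairDigit u (just (z , b))
    opposite true = refl
    opposite false = refl

  mirror-nonroot : ∀ u → u ≢ v → mirror u ≢ v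
  mirror-nonroot u u≢v with parent u FP.≟ v
  ... | yes _ = u≢v
  ... | no pu≢v with sibling u in su
  ...   | nothing = u≢v
  ...   | just (z , b) = proj₂ (Partners.partner-child (partners pu≢v su))

  mirror-involutive : ∀ u → u ≢ v → mirror (mirror u) ≡ u
  mirror-involutive u u≢v with parent u FP.≟ v
  ... | yes pu≡v = mirror-rootChild u pu≡v
  ... | no pu≢v with sibling u in su
  ...   | nothing = trans (mirror-inner u pu≢v) (cong (pairMirror u) su)
  ...   | just (z , b) = Partners.mirror-right (partners pu≢v su)

  double-index-injective : ∀ (x y : Fin m) → 2 ℕ.* F.toℕ x ≡ 2 ℕ.* F.toℕ y → x ≡ y
  double-index-injective x y eq = FP.toℕ-injective (ℕP.*-cancelˡ-≡ (F.toℕ x) (F.toℕ y) 2 eq)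

  pairDigit-injective : ∀ l {x y} → Unique l → x ∈ l → y ∈ l →
                        pairDigit x (partner l x) ≡ pairDigit y (partner l y) → x ≡ y
  pairDigit-injective l {x} {y} ul x∈ y∈ eq with partner l x in px | partner l y in py
  ... | nothing | nothing = unpaired-unique l x∈ y∈ px py
  ... | just (z , true) | just (z′ , true) = double-index-injective x y (ℕP.suc-injective (ℤP.+-injective eq))
  ... | just (z , false) | just (z′ , false)
    with double-index-injective z z′ (ℤP.-[1+-injective eq)
  ... | refl = just-injective (trans (sym (proj₂ (partner-symmetric l x ul px))) (proj₂ (partner-symmetric l y ul py)))
    where
    just-injective : ∀ {a b : Fin m} → just (a , true) ≡ just (b , true) → a ≡ b
    just-injective refl = refl
  pairDigit-injective l ul x∈ y∈ () | nothing | just (_ , true)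
  pairDigit-injective l ul x∈ y∈ () | nothing | just (_ , false)
  pairDigit-injective l ul x∈ y∈ () | just (_ , true) | nothing
  pairDigit-injective l ul x∈ y∈ () | just (_ , true) | just (_ , false)
  pairDigit-injective l ul x∈ y∈ () | just (_ , false) | nothing
  pairDigit-injective l ul x∈ y∈ () | just (_ , false) | just (_ , true)

  siblings-injective : ∀ x y → parent x ≡ parent y → x ≢ v → y ≢ v → digit x ≡ digit y → x ≡ y
  siblings-injective x y px≡py x≢v y≢v eq with parent x FP.≟ v | parent y FP.≟ v
  ... | yes _ | yes _ = double-index-injective x y (ℕP.suc-injective (ℤP.+-injective eq))
  ... | yes px≡v | no py≢v = ⊥-elim (py≢v (trans (sym px≡py) px≡v))
  ... | no px≢v | yes py≡v = ⊥-elim (px≢v (trans px≡py py≡v))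
  ... | no _ | no _ = pairDigit-injective (children (parent x)) (children-unique (parent x))
        (∈children⁺ (refl , x≢v)) (∈children⁺ (sym px≡py , y≢v))
        (trans eq (cong (λ w → pairDigit y (partner (children w) y)) (sym px≡py)))

  -- the base of the signed expansions; 2 · |digit| < Q
  Q : ℕ
  Q = suc (4 ℕ.* m)

  offsetAlong : ℕ → Fin m → ℤ
  offsetAlong zero u = 0ℤ
  offsetAlong (suc n) u = offsetAlong n (parent u) ℤ.+ digit u ℤ.* + (Q ℕ.^ suc n)

  offset : Fin m → ℤ
  offset u = offsetAlong (depth u) u

  offset-root : offset v ≡ 0ℤ
  offset-root = cong (λ n → offsetAlong n v) depth-root

  parent-depth : ∀ u n → depth u ≡ suc n → depth (parent u) ≡ n
  parent-depth u n du = ℕP.suc-injective (trans (depth-parent u (depth-suc⇒≢root du)) du)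

  offset-step : ∀ u n → depth u ≡ suc n → offset u ≡ offset (parent u) ℤ.+ digit u ℤ.* + (Q ℕ.^ suc n)
  offset-step u n du = trans (cong (λ k → offsetAlong k u) du)
    (cong (λ k → offsetAlong k (parent u) ℤ.+ digit u ℤ.* + (Q ℕ.^ suc n)) (sym (parent-depth u n du)))

  offset-above : ∀ u → u ≢ v → offset u ≡ offset (parent u) ℤ.+ digit u ℤ.* + (Q ℕ.^ depth u)
  offset-above u u≢v = trans (offset-step u _ (sym (depth-parent u u≢v)))
    (cong (λ k → offset (parent u) ℤ.+ digit u ℤ.* + (Q ℕ.^ k)) (depth-parent u u≢v))

  offset-bound : ∀ n u → depth u ≡ n → 2 ℕ.* ℤ.∣ offset u ∣ < Q ℕ.^ suc n
  offset-bound zero u du rewrite depth≡0⇒root u du | offset-root = s≤s z≤n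
  offset-bound (suc n) u du = begin-strict
      2 ℕ.* ℤ.∣ offset u ∣
        ≡⟨ cong (λ t → 2 ℕ.* ℤ.∣ t ∣) (offset-step u n du) ⟩
      2 ℕ.* ℤ.∣ offset p ℤ.+ s ℤ.* + K ∣
        ≤⟨ ℕP.*-monoʳ-≤ 2 (ℤP.∣i+j∣≤∣i∣+∣j∣ (offset p) (s ℤ.* + K)) ⟩
      2 ℕ.* (ℤ.∣ offset p ∣ ℕ.+ ℤ.∣ s ℤ.* + K ∣)
        ≡⟨ cong (λ t → 2 ℕ.* (ℤ.∣ offset p ∣ ℕ.+ t)) (ℤP.∣i*j∣≡∣i∣*∣j∣ s (+ K)) ⟩
      2 ℕ.* (ℤ.∣ offset p ∣ ℕ.+ ℤ.∣ s ∣ ℕ.* K)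
        ≡⟨ ℕP.*-distribˡ-+ 2 (ℤ.∣ offset p ∣) (ℤ.∣ s ∣ ℕ.* K) ⟩
      2 ℕ.* ℤ.∣ offset p ∣ ℕ.+ 2 ℕ.* (ℤ.∣ s ∣ ℕ.* K)
        <⟨ ℕP.+-monoˡ-< _ (offset-bound n p (parent-depth u n du)) ⟩
      K ℕ.+ 2 ℕ.* (ℤ.∣ s ∣ ℕ.* K)
        ≡⟨ cong (K ℕ.+_) (sym (ℕP.*-assoc 2 ℤ.∣ s ∣ K)) ⟩
      K ℕ.+ (2 ℕ.* ℤ.∣ s ∣) ℕ.* K
        ≤⟨ ℕP.+-monoʳ-≤ K (ℕP.*-monoˡ-≤ K (ℕP.*-monoʳ-≤ 2 (digit-bound u))) ⟩
      K ℕ.+ (2 ℕ.* (2 ℕ.* m)) ℕ.* K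
        ≡⟨ cong (λ t → K ℕ.+ t ℕ.* K) (sym (ℕP.*-assoc 2 2 m)) ⟩
      Q ℕ.* K ∎
    where
    open ℕP.≤-Reasoning
    p : Fin m
    p = parent u
    s : ℤ
    s = digit u
    K : ℕ
    K = Q ℕ.^ suc n

  offset-injective : ∀ n x y → depth x ≡ n → depth y ≡ n → offset x ≡ offset y → x ≡ y
  offset-injective zero x y dx dy _ = trans (depth≡0⇒root x dx) (sym (depth≡0⇒root y dy))
  offset-injective (suc n) x y dx dy eq =
    siblings-injective x y parents-equal (depth-suc⇒≢root dx) (depth-suc⇒≢root dy) digits-equal
    where
    K : ℕ
    K = Q ℕ.^ suc n
    expansions : offset (parent x) ℤ.+ digit x ℤ.* + K ≡ offset (parent y) ℤ.+ digit y ℤ.* + K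
    expansions = trans (sym (offset-step x n dx)) (trans eq (offset-step y n dy))
    digits-equal : digit x ≡ digit y
    digits-equal = leading-digit-unique (offset (parent x)) (offset (parent y)) (digit x) (digit y) K
      (offset-bound n (parent x) (parent-depth x n dx)) (offset-bound n (parent y) (parent-depth y n dy)) expansions
    parents-equal : parent x ≡ parent y
    parents-equal = offset-injective n (parent x) (parent y) (parent-depth x n dx) (parent-depth y n dy)
      (∙-cancelʳ (digit x ℤ.* + K) (offset (parent x)) (offset (parent y))
        (trans expansions (cong (λ s → offset (parent y) ℤ.+ s ℤ.* + K) (sym digits-equal))))

  depthBound : ℕ
  depthBound = sum (map depth (allFin m))

  depth≤depthBound : ∀ u → depth u ≤ depthBound
  depth≤depthBound u = ≤-sum depth (∈-allFin u)

  -- adding shift makes every offset non-negative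
  shift : ℕ
  shift = Q ℕ.^ suc depthBound

  offset≤shift : ∀ u → ℤ.∣ offset u ∣ ≤ shift
  offset≤shift u = ℕP.<⇒≤ (ℕP.≤-<-trans (ℕP.m≤n*m ℤ.∣ offset u ∣ 2)
    (ℕP.<-≤-trans (offset-bound (depth u) u refl) (ℕP.^-monoʳ-≤ Q (s≤s (depth≤depthBound u)))))

  private
    shiftedWitness : ∀ u → Σ ℕ λ w → + shift ℤ.+ offset u ≡ + w
    shiftedWitness u = shift-to-ℕ shift (offset u) (offset≤shift u)

  shifted : Fin m → ℕ
  shifted u = proj₁ (shiftedWitness u)

  shifted-spec : ∀ u → + shift ℤ.+ offset u ≡ + shifted u
  shifted-spec u = proj₂ (shiftedWitness u)

  shifted-unpaired : ∀ u → u ≢ v → digit u ≡ 0ℤ → shifted u ≡ shifted (parent u)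
  shifted-unpaired u u≢v digit≡0 = ℤP.+-injective (begin
      + shifted u                                                  ≡⟨ sym (shifted-spec u) ⟩
      + shift ℤ.+ offset u                                         ≡⟨ cong (ℤ._+_ (+ shift)) (offset-above u u≢v) ⟩
      + shift ℤ.+ (offset (parent u) ℤ.+ digit u ℤ.* + (Q ℕ.^ depth u))
        ≡⟨ cong (λ s → + shift ℤ.+ (offset (parent u) ℤ.+ s ℤ.* + (Q ℕ.^ depth u))) digit≡0 ⟩
      + shift ℤ.+ (offset (parent u) ℤ.+ 0ℤ)                       ≡⟨ cong (ℤ._+_ (+ shift)) (ℤP.+-identityʳ (offset (parent u))) ⟩
      + shift ℤ.+ offset (parent u)                                ≡⟨ shifted-spec (parent u) ⟩
      + shifted (parent u) ∎)
    where open ≡-Reasoning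

  depth-partner : ∀ {u z} → u ≢ v → Partners u z → depth z ≡ depth u
  depth-partner {u} {z} u≢v pr = begin
    depth z                      ≡⟨ sym (depth-parent z (proj₂ child)) ⟩
    suc (depth (parent z))       ≡⟨ cong (λ w → suc (depth w)) (proj₁ child) ⟩
    suc (depth (parent u))       ≡⟨ depth-parent u u≢v ⟩
    depth u ∎
    where
    open ≡-Reasoning
    child : IsChild (parent u) z
    child = Partners.partner-child pr

  shifted-partners : ∀ {u z} → u ≢ v → Partners u z → shifted u ℕ.+ shifted z ≡ 2 ℕ.* shifted (parent u)
  shifted-partners {u} {z} u≢v pr = ℤP.+-injective (begin
      + shifted u ℤ.+ + shifted z
        ≡⟨ cong₂ ℤ._+_ (sym (shifted-spec u)) (sym (shifted-spec z)) ⟩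
      (+ shift ℤ.+ offset u) ℤ.+ (+ shift ℤ.+ offset z)
        ≡⟨ cong₂ (λ a b → (+ shift ℤ.+ a) ℤ.+ (+ shift ℤ.+ b)) (offset-above u u≢v) (offset-above z z≢v) ⟩
      (+ shift ℤ.+ (offset p ℤ.+ digit u ℤ.* K)) ℤ.+ (+ shift ℤ.+ (offset (parent z) ℤ.+ digit z ℤ.* + (Q ℕ.^ depth z)))
        ≡⟨ cong (λ b → (+ shift ℤ.+ (offset p ℤ.+ digit u ℤ.* K)) ℤ.+ (+ shift ℤ.+ b)) partner-expansion ⟩
      (+ shift ℤ.+ (offset p ℤ.+ digit u ℤ.* K)) ℤ.+ (+ shift ℤ.+ (offset p ℤ.+ ℤ.- digit u ℤ.* K))
        ≡⟨ cancel-digits (+ shift) (offset p) (digit u) K ⟩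
      (+ shift ℤ.+ offset p) ℤ.+ (+ shift ℤ.+ offset p)
        ≡⟨ cong₂ ℤ._+_ (shifted-spec p) (shifted-spec p) ⟩
      + shifted p ℤ.+ + shifted p
        ≡⟨ cong (λ t → + (shifted p ℕ.+ t)) (sym (ℕP.+-identityʳ (shifted p))) ⟩
      + (2 ℕ.* shifted p) ∎)
    where
    open ≡-Reasoning
    p : Fin m
    p = parent u
    K : ℤ
    K = + (Q ℕ.^ depth u)
    child : IsChild p z
    child = Partners.partner-child pr
    z≢v : z ≢ v
    z≢v = proj₂ child
    partner-expansion : offset (parent z) ℤ.+ digit z ℤ.* + (Q ℕ.^ depth z) ≡ offset p ℤ.+ ℤ.- digit u ℤ.* K
    partner-expansion = cong₃ (λ w s d → offset w ℤ.+ s ℤ.* + (Q ℕ.^ d))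
      (proj₁ child) (Partners.digit-opposite pr) (depth-partner u≢v pr)
      where
      cong₃ : ∀ {A B C X : Set} (f : A → B → C → X) {a a′ b b′ c c′} → a ≡ a′ → b ≡ b′ → c ≡ c′ → f a b c ≡ f a′ b′ c′
      cong₃ f refl refl refl = refl
    cancel-digits : ∀ T a s K → (T ℤ.+ (a ℤ.+ s ℤ.* K)) ℤ.+ (T ℤ.+ (a ℤ.+ ℤ.- s ℤ.* K)) ≡ (T ℤ.+ a) ℤ.+ (T ℤ.+ a)
    cancel-digits = solve-∀

  label : Fin m → ℕ
  label u with u FP.≟ v
  ... | yes _ = 0
  ... | no _ = 2 ℕ.^ (depthBound ℕ.∸ depth u) ℕ.* suc (2 ℕ.* shifted u)

  label-root : label v ≡ 0
  label-root with v FP.≟ v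
  ... | yes _ = refl
  ... | no v≢v = ⊥-elim (v≢v refl)

  label-nonroot : ∀ u → u ≢ v → label u ≡ 2 ℕ.^ (depthBound ℕ.∸ depth u) ℕ.* suc (2 ℕ.* shifted u)
  label-nonroot u u≢v with u FP.≟ v
  ... | yes u≡v = ⊥-elim (u≢v u≡v)
  ... | no _ = refl

  label-sum : ∀ u z → u ≢ v → z ≢ v → parent u ≢ v → depth z ≡ depth u →
              shifted u ℕ.+ shifted z ≡ 2 ℕ.* shifted (parent u) → label (parent u) ≡ label u ℕ.+ label z
  label-sum u z u≢v z≢v pu≢v dz≡du average = sym (begin
      label u ℕ.+ label z
        ≡⟨ cong₂ ℕ._+_ (label-nonroot u u≢v)
             (trans (label-nonroot z z≢v) (cong (λ k → 2 ℕ.^ (depthBound ℕ.∸ k) ℕ.* odd z) dz≡du)) ⟩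
      P ℕ.* odd u ℕ.+ P ℕ.* odd z               ≡⟨ sym (ℕP.*-distribˡ-+ P (odd u) (odd z)) ⟩
      P ℕ.* (odd u ℕ.+ odd z)                   ≡⟨ cong (P ℕ.*_) odds ⟩
      P ℕ.* (2 ℕ.* odd (parent u))              ≡⟨ sym (ℕP.*-assoc P 2 _) ⟩
      (P ℕ.* 2) ℕ.* odd (parent u)              ≡⟨ cong (ℕ._* odd (parent u)) (ℕP.*-comm P 2) ⟩
      2 ℕ.^ suc (depthBound ℕ.∸ depth u) ℕ.* odd (parent u)
        ≡⟨ cong (λ k → 2 ℕ.^ k ℕ.* odd (parent u)) (sym exponent) ⟩
      2 ℕ.^ (depthBound ℕ.∸ depth (parent u)) ℕ.* odd (parent u) ≡⟨ sym (label-nonroot (parent u) pu≢v) ⟩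
      label (parent u) ∎)
    where
    open ≡-Reasoning
    odd : Fin m → ℕ
    odd w = suc (2 ℕ.* shifted w)
    P : ℕ
    P = 2 ℕ.^ (depthBound ℕ.∸ depth u)
    odds : odd u ℕ.+ odd z ≡ 2 ℕ.* odd (parent u)
    odds = trans (odd-sum (shifted u) (shifted z)) (cong (λ t → 2 ℕ.* suc t) average)
      where
      odd-sum : ∀ a b → suc (2 ℕ.* a) ℕ.+ suc (2 ℕ.* b) ≡ 2 ℕ.* suc (a ℕ.+ b)
      odd-sum = ℕSolver.solve-∀
    exponent : depthBound ℕ.∸ depth (parent u) ≡ suc (depthBound ℕ.∸ depth u)
    exponent = trans
      (∸-pred depthBound (depth (parent u)) (subst (_≤ depthBound) (sym (depth-parent u u≢v)) (depth≤depthBound u)))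
      (cong (λ k → suc (depthBound ℕ.∸ k)) (depth-parent u u≢v))

  parent-edge-label : ∀ u → u ≢ v → ∣ label u - label (parent u) ∣ ≡ label (mirror u)
  parent-edge-label u u≢v = by-parent (parent u FP.≟ v)
    where
    open ≡-Reasoning
    Goal : Set
    Goal = ∣ label u - label (parent u) ∣ ≡ label (mirror u)

    by-sibling : parent u ≢ v → ∀ s → sibling u ≡ s → Goal
    by-sibling pu≢v nothing su = begin
      ∣ label u - label (parent u) ∣       ≡⟨ cong (∣ label u -_∣) (label-sum u u u≢v u≢v pu≢v refl average) ⟩
      ∣ label u - label u ℕ.+ label u ∣    ≡⟨ ℕP.∣m-m+n∣≡n (label u) (label u) ⟩
      label u                              ≡⟨ cong label (sym (trans (mirror-inner u pu≢v) (cong (pairMirror u) su))) ⟩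
      label (mirror u) ∎
      where
      average : shifted u ℕ.+ shifted u ≡ 2 ℕ.* shifted (parent u)
      average rewrite shifted-unpaired u u≢v (trans (digit-inner u pu≢v) (cong (pairDigit u) su)) =
        cong (shifted (parent u) ℕ.+_) (sym (ℕP.+-identityʳ _))
    by-sibling pu≢v (just (z , b)) su = begin
      ∣ label u - label (parent u) ∣       ≡⟨ cong (∣ label u -_∣) (label-sum u z u≢v (proj₂ (Partners.partner-child pr))
                                               pu≢v (depth-partner u≢v pr) (shifted-partners u≢v pr)) ⟩
      ∣ label u - label u ℕ.+ label z ∣    ≡⟨ ℕP.∣m-m+n∣≡n (label u) (label z) ⟩
      label z                              ≡⟨ cong label (sym (Partners.mirror-left pr)) ⟩
      label (mirror u) ∎
      where
      pr : Partners u z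
      pr = partners pu≢v su

    by-parent : Dec (parent u ≡ v) → Goal
    by-parent (yes pu≡v) = begin
      ∣ label u - label (parent u) ∣ ≡⟨ cong (λ w → ∣ label u - label w ∣) pu≡v ⟩
      ∣ label u - label v ∣          ≡⟨ cong (∣ label u -_∣) label-root ⟩
      ∣ label u - 0 ∣                ≡⟨ ℕP.∣-∣-identityʳ (label u) ⟩
      label u                        ≡⟨ cong label (sym (mirror-rootChild u pu≡v)) ⟩
      label (mirror u) ∎
    by-parent (no pu≢v) = by-sibling pu≢v (sibling u) refl

  positive : ∀ u → u ≢ v → 0 ≢ label u
  positive u u≢v eq = ℕP.<⇒≢ (ℕP.*-mono-≤ (ℕP.m^n>0 2 (depthBound ℕ.∸ depth u)) (s≤s z≤n))
                             (trans eq (label-nonroot u u≢v))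

  -- the 2-adic valuation of a label recovers the depth, its odd part the offset
  label-injective : ∀ x y → label x ≡ label y → x ≡ y
  label-injective x y eq = by-root (x FP.≟ v) (y FP.≟ v)
    where
    by-root : Dec (x ≡ v) → Dec (y ≡ v) → x ≡ y
    by-root (yes x≡v) (yes y≡v) = trans x≡v (sym y≡v)
    by-root (yes x≡v) (no y≢v) = ⊥-elim (positive y y≢v (trans (sym (trans (cong label x≡v) label-root)) eq))
    by-root (no x≢v) (yes y≡v) = ⊥-elim (positive x x≢v (trans (sym (trans (cong label y≡v) label-root)) (sym eq)))
    by-root (no x≢v) (no y≢v) = offset-injective (depth x) x y refl (sym depths) offsets
      where
      parts : depthBound ℕ.∸ depth x ≡ depthBound ℕ.∸ depth y × shifted x ≡ shifted y
      parts = odd-part-unique (depthBound ℕ.∸ depth x) (depthBound ℕ.∸ depth y) (shifted x) (shifted y)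
        (trans (sym (label-nonroot x x≢v)) (trans eq (label-nonroot y y≢v)))
      depths : depth x ≡ depth y
      depths = trans (sym (ℕP.m∸[m∸n]≡n (depth≤depthBound x)))
        (trans (cong (depthBound ℕ.∸_) (proj₁ parts)) (ℕP.m∸[m∸n]≡n (depth≤depthBound y)))
      offsets : offset x ≡ offset y
      offsets = ∙-cancelˡ (+ shift) (offset x) (offset y)
        (trans (shifted-spec x) (trans (cong +_ (proj₂ parts)) (sym (shifted-spec y))))

  anchored : AnchoredLabelling E v
  anchored = Mirrored.anchored E v tree label label-injective label-root
               mirror mirror-nonroot mirror-involutive parent-edge-label

mainTheorem8 : (m : ℕ) (E : Edges m) → IsTree E → (v : Fin m) →
    Σ ℕ (λ N → (k : ℕ) → N ≤ k → Graceful (attachLeaves E v k))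
mainTheorem8 m E tree v =
  WithLeaves.graceful-with-leaves E v (proj₁ (proj₁ tree)) (Construction.anchored E v tree)
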